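{- Assume ZFC. Let $\langle f_\alpha:\alpha<\mathfrak{b}\rangle$ be a $<^*$-increasing, $<^*$-unbounded sequence in $\omega^\omega$ with each $f_\alpha$ increasing. For $x\in(2^\omega)^\omega\cong 2^{\omega\times\omega}$ let $c(x)=\langle [x\restriction f_\alpha]:\alpha<\mathfrak{b}\rangle$. Then $c$ is a complete classification of $E_1$, i.e. for all $x,y$: $x\mathrel{E_1}y\iff c(x)=c(y)$.
   Context: Elements $x\in(2^\omega)^\omega$ are identified with functions $x\colon\omega\times\omega\to\{0,1\}$, where $x(n,m)$ is the $m$-th entry of the $n$-th column. $x\mathrel{E_1}y$ iff $x$ and $y$ agree on all but finitely many columns. For $f\colon\omega\to\omega+1$, $x\restriction f$ is the restriction of $x$ to $\{(n,m):m<f(n)\}$. For a partial function $y$, $[y]$ is the set of all functions with the same domain as $y$ differing from $y$ in at most finitely many places. $<^*$ is eventual domination on $\omega^\omega$, and $\mathfrak{b}$ is the bounding number. -}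

module Defs where

open import Data.Nat using (ℕ; _<_; _≤_)
open import Data.Bool using (Bool)
open import Data.Product using (Σ; ∃; _×_; _,_)
open import Data.Sum using (_⊎_)
open import Data.List using (List)
open import Data.List.Membership.Propositional using (_∈_)
open import Relation.Binary.PropositionalEquality using (_≡_; _≢_)
open import Relation.Nullary using (¬_)
open import Relation.Binary.Structures using (IsStrictTotalOrder)
open import Induction.WellFounded using (WellFounded)
open import Function.Bundles using (_↣_)

-- Classical logic (ZFC is classical): excluded middle for all propositions in Set.
ExcludedMiddle : Set₁
ExcludedMiddle = (P : Set) → P ⊎ ¬ P

Baire : Set
Baire = ℕ → ℕ

_<*_ : Baire → Baire → Set
f <* g = ∃ λ N → ∀ n → N ≤ n → f n < g n

Bounded : {J : Set} → (J → Baire) → Set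
Bounded {J} F = ∃ λ (g : Baire) → ∀ j → F j <* g

Unbounded : {J : Set} → (J → Baire) → Set
Unbounded F = ¬ Bounded F

Increasing : Baire → Set
Increasing f = ∀ n m → n < m → f n < f m

-- (I , _≺_) is (order-isomorphic to) the ordinal 𝔟:
--  * a well-order,
--  * an initial ordinal: no proper initial segment is equinumerous with (injects onto) I,
--  * |I| ≤ |J| for every index set J of an unbounded family (|I| ≤ 𝔟;
--    the reverse inequality 𝔟 ≤ |I| is supplied separately by the
--    unboundedness of the given family indexed by I).
record IsWellOrder (I : Set) (_≺_ : I → I → Set) : Set where
  field
    strictTotal  : IsStrictTotalOrder _≡_ _≺_
    wellFounded  : WellFounded _≺_

record IsInitialOrdinalOfSizeAtMostB (I : Set) (_≺_ : I → I → Set) : Set₁ where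
  field
    wellOrder : IsWellOrder I _≺_
    initial   : ∀ (α : I) → ¬ (I ↣ Σ I (λ β → β ≺ α))
    atMostB   : ∀ (J : Set) (G : J → Baire) → Unbounded G → I ↣ J

-- Elements of (2^ω)^ω: x n m is the m-th entry of the n-th column.
Matrix : Set
Matrix = ℕ → ℕ → Bool

E₁ : Matrix → Matrix → Set
E₁ x y = ∃ λ (L : List ℕ) → ∀ n → ¬ (∀ m → x n m ≡ y n m) → n ∈ L

-- [x ↾ f] = [y ↾ f] : the restrictions to {(n,m) : m < f n} differ in
-- at most finitely many places (listed in L).
SameClassRestr : Baire → Matrix → Matrix → Set
SameClassRestr f x y =
  ∃ λ (L : List (ℕ × ℕ)) → ∀ n m → m < f n → x n m ≢ y n m → (n , m) ∈ L

-- c(x) = c(y) where c(x) = ⟨ [x ↾ f α] : α < 𝔟 ⟩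
SameInvariant : {I : Set} → (I → Baire) → Matrix → Matrix → Set
SameInvariant {I} f x y = ∀ (α : I) → SameClassRestr (f α) x y

{-# OPTIONS --safe #-}
-- Only unboundedness of the family matters.  If x and y differ in only finitely many
-- columns, each restriction x ↾ f α differs from y ↾ f α in the finitely many cells of
-- those columns below f α.  Conversely, if x and y differ in infinitely many columns,
-- choose for each n a difference (k , m) with n ≤ k and put h n = m + 1.  Once n passes
-- the columns of the finite set of differences of x ↾ f α and y ↾ f α, that difference
-- lies outside x ↾ f α, so f α n ≤ f α k ≤ m < h n; thus h would bound every f α.
module Submission where

open import Defs
open import Function.Base using (_∘_)
open import Function.Bundles using (_⇔_; mk⇔)
open import Data.Nat using (ℕ; suc; _<_; _≤_; _≤?_; s≤s)
open import Data.Nat.Properties using (≤-refl; ≤-trans; <⇒≤; <⇒≱; ≰⇒>; m≤n⇒m<n∨m≡n)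
open import Data.Bool.Properties using (_≟_)
open import Data.Product using (∃; _×_; _,_; proj₁)
open import Data.Sum using (inj₁; inj₂)
open import Data.List using (List; map; concatMap; upTo)
open import Data.List.Extrema.Nat using (max; xs≤max)
open import Data.List.Membership.Propositional using (_∈_)
open import Data.List.Membership.Propositional.Properties using (∈-map⁺; ∈-upTo⁺; ∈-concatMap⁺)
import Data.List.Relation.Unary.Any as Any
import Data.List.Relation.Unary.All as All
open import Data.Empty using (⊥-elim)
open import Relation.Binary.Definitions using (Monotonic₁)
open import Relation.Binary.PropositionalEquality using (_≡_; _≢_; refl)
open import Relation.Nullary using (¬_; yes; no)
open import Relation.Nullary.Decidable using (decidable-stable)

Increasing⇒monotonic : ∀ {g} → Increasing g → Monotonic₁ _≤_ _≤_ g
Increasing⇒monotonic inc {n} {k} n≤k with m≤n⇒m<n∨m≡n n≤k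
... | inj₁ n<k  = <⇒≤ (inc n k n<k)
... | inj₂ refl = ≤-refl

cellsBelow : Baire → List ℕ → List (ℕ × ℕ)
cellsBelow g = concatMap (λ n → map (n ,_) (upTo (g n)))

∈-cellsBelow : ∀ {g L n m} → n ∈ L → m < g n → (n , m) ∈ cellsBelow g L
∈-cellsBelow n∈L m<gn = ∈-concatMap⁺ _ (Any.map (λ { refl → ∈-map⁺ _ (∈-upTo⁺ m<gn) }) n∈L)

E₁⇒SameClassRestr : ∀ g {x y} → E₁ x y → SameClassRestr g x y
E₁⇒SameClassRestr g (L , cover) = cellsBelow g L , λ n m m<gn xm≢ym →
  ∈-cellsBelow (cover n (λ column≡ → xm≢ym (column≡ m))) m<gn

columnBound : List (ℕ × ℕ) → ℕ
columnBound L = suc (max 0 (map proj₁ L))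

column<columnBound : ∀ {L a b} → (a , b) ∈ L → a < columnBound L
column<columnBound {L} ab∈L = s≤s (All.lookup (xs≤max 0 (map proj₁ L)) (∈-map⁺ proj₁ ab∈L))

DifferenceFrom : Matrix → Matrix → ℕ → Set
DifferenceFrom x y n = ∃ λ k → ∃ λ m → n ≤ k × x k m ≢ y k m

row : ∀ {x y n} → DifferenceFrom x y n → ℕ
row (_ , m , _) = m

¬E₁⇒differenceFrom : ExcludedMiddle → ∀ {x y} → ¬ E₁ x y → ∀ n → DifferenceFrom x y n
¬E₁⇒differenceFrom em {x} {y} ¬E₁ n with em (DifferenceFrom x y n)
... | inj₁ d  = d
... | inj₂ ¬d = ⊥-elim (¬E₁ (upTo n , λ k k-differs → ∈-upTo⁺ (column<n k k-differs)))
  where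
  column<n : ∀ k → ¬ (∀ m → x k m ≡ y k m) → k < n
  column<n k k-differs with n ≤? k
  ... | no n≰k  = ≰⇒> n≰k
  ... | yes n≤k = ⊥-elim (k-differs λ m →
    decidable-stable (x k m ≟ y k m) (λ xm≢ym → ¬d (k , m , n≤k , xm≢ym)))

SameClassRestr⇒<*rows : ∀ {g x y} → Monotonic₁ _≤_ _≤_ g → SameClassRestr g x y →
  (d : ∀ n → DifferenceFrom x y n) → g <* (suc ∘ row ∘ d)
SameClassRestr⇒<*rows {g} {x} {y} mono (L , cover) d = columnBound L , λ n B≤n → bounded n B≤n (d n)
  where
  bounded : ∀ n → columnBound L ≤ n → (dₙ : DifferenceFrom x y n) → g n < suc (row dₙ)
  bounded n B≤n (k , m , n≤k , xm≢ym) with g k ≤? m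
  ... | yes gk≤m = s≤s (≤-trans (mono n≤k) gk≤m)
  ... | no gk≰m  = ⊥-elim (<⇒≱ (column<columnBound (cover k m (≰⇒> gk≰m) xm≢ym)) (≤-trans B≤n n≤k))

E₁⇔SameInvariant : ExcludedMiddle → ∀ {J} (f : J → Baire) →
  Unbounded f → (∀ α → Monotonic₁ _≤_ _≤_ (f α)) →
  (x y : Matrix) → E₁ x y ⇔ SameInvariant f x y
E₁⇔SameInvariant em f unbounded mono x y = mk⇔ (λ e α → E₁⇒SameClassRestr (f α) e) from
  where
  from : SameInvariant f x y → E₁ x y
  from same with em (E₁ x y)
  ... | inj₁ e  = e
  ... | inj₂ ¬e = ⊥-elim (unbounded (suc ∘ row ∘ d , λ α → SameClassRestr⇒<*rows (mono α) (same α) d))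
    where
    d : ∀ n → DifferenceFrom x y n
    d = ¬E₁⇒differenceFrom em ¬e

claim2p5 : ExcludedMiddle →
    (I : Set) (_≺_ : I → I → Set) → IsInitialOrdinalOfSizeAtMostB I _≺_ →
    (f : I → Baire) →
    (∀ α β → α ≺ β → f α <* f β) →
    Unbounded f →
    (∀ α → Increasing (f α)) →
    (x y : Matrix) → E₁ x y ⇔ SameInvariant f x y
claim2p5 em I _≺_ _ f _ unbounded increasing =
  E₁⇔SameInvariant em f unbounded (Increasing⇒monotonic ∘ increasing)
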